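{- Let $P,Q$ be binary predicate symbols, $r$ a constant symbol, $t_1,t_2$ unary function symbols, and $\alpha,\beta_1,\beta_2$ variables. Consider the sequent $\forall x.(P(x,t_1x)\land Q(x,t_2x))\vdash\exists x,y.(P(r,x)\land Q(r,y))$, the schematic $\Pi_2$-grammar with nonterminals $\tau,\alpha,\beta_1,\beta_2$ and productions $\tau\to h_F\alpha$, $\tau\to h_G\beta_1\beta_2$, $\alpha\to r\mid r$, $\beta_2\to t_1r\mid t_2r$, $\beta_1\to t_1r\mid t_2r$, and the schematic extended Herbrand sequent $$S(X):\quad P(\alpha,t_1\alpha)\land Q(\alpha,t_2\alpha),\ X(\alpha,t_1\alpha)\lor X(\alpha,t_2\alpha)\to X(r,\beta_1)\land X(r,\beta_2)\ \vdash\ P(r,\beta_1)\land Q(r,\beta_2),$$ where $X$ is a binary predicate variable. Then $S(X)$ has no solution: there is no formula $C$ (with free variables among the designated variables $x,y$) such that $S(C)$, obtained by replacing each $X(s,t)$ by $C[x\backslash s,y\backslash t]$, is a tautology.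
   Context: A sequent is a tautology if it is valid in classical first-order logic. $h_F,h_G$ are auxiliary function symbols representing the instances of the quantified formulas of the antecedent and succedent. -}

module Defs where

open import Data.Nat using (ℕ; zero; suc)
open import Data.Fin using (Fin; zero; suc)
open import Data.Product using (Σ; _×_; _,_)
open import Data.Sum using (_⊎_)
open import Data.Empty using (⊥)
open import Data.Unit using (⊤)
open import Data.List using (List; []; _∷_)
open import Data.List.Relation.Unary.All using (All)
open import Data.List.Relation.Unary.Any using (Any)
open import Relation.Nullary using (¬_)

data Term (n : ℕ) : Set where
  var : Fin n → Term n
  r   : Term n
  t₁  : Term n → Term n
  t₂  : Term n → Term n

infixr 6 _∧'_
infixr 5 _∨'_
infixr 4 _⇒'_

data Formula (n : ℕ) : Set where
  P Q  : Term n → Term n → Formula n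
  ⊤' ⊥' : Formula n
  ¬'_  : Formula n → Formula n
  _∧'_ _∨'_ _⇒'_ : Formula n → Formula n → Formula n
  ∀' ∃' : Formula (suc n) → Formula n

liftR : ∀ {m n} → (Fin m → Fin n) → Fin (suc m) → Fin (suc n)
liftR ρ zero    = zero
liftR ρ (suc i) = suc (ρ i)

renT : ∀ {m n} → (Fin m → Fin n) → Term m → Term n
renT ρ (var i) = var (ρ i)
renT ρ r       = r
renT ρ (t₁ t)  = t₁ (renT ρ t)
renT ρ (t₂ t)  = t₂ (renT ρ t)

liftS : ∀ {m n} → (Fin m → Term n) → Fin (suc m) → Term (suc n)
liftS σ zero    = var zero
liftS σ (suc i) = renT suc (σ i)

subT : ∀ {m n} → (Fin m → Term n) → Term m → Term n
subT σ (var i) = σ i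
subT σ r       = r
subT σ (t₁ t)  = t₁ (subT σ t)
subT σ (t₂ t)  = t₂ (subT σ t)

subF : ∀ {m n} → (Fin m → Term n) → Formula m → Formula n
subF σ (P a b)  = P (subT σ a) (subT σ b)
subF σ (Q a b)  = Q (subT σ a) (subT σ b)
subF σ ⊤'       = ⊤'
subF σ ⊥'       = ⊥'
subF σ (¬' A)   = ¬' subF σ A
subF σ (A ∧' B) = subF σ A ∧' subF σ B
subF σ (A ∨' B) = subF σ A ∨' subF σ B
subF σ (A ⇒' B) = subF σ A ⇒' subF σ B
subF σ (∀' A)   = ∀' (subF (liftS σ) A)
subF σ (∃' A)   = ∃' (subF (liftS σ) A)

-- C[x\s, y\t] for a formula C with free variables among x (= var 0), y (= var 1)
pair : ∀ {n} → Term n → Term n → Fin 2 → Term n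
pair s t zero       = s
pair s t (suc zero) = t

_[_,_] : ∀ {n} → Formula 2 → Term n → Term n → Formula n
C [ s , t ] = subF (pair s t) C

-- Classical semantics (Tarski semantics, with ∨, ∃ and atoms read through
-- double negation, i.e. the Gödel–Gentzen reading, so that validity is
-- classical validity).

record Structure : Set₁ where
  field
    D    : Set
    Pᴹ Qᴹ : D → D → Set
    rᴹ   : D
    t₁ᴹ t₂ᴹ : D → D

open Structure

cons : ∀ {n} {A : Set} → A → (Fin n → A) → Fin (suc n) → A
cons a ρ zero    = a
cons a ρ (suc i) = ρ i

evalT : ∀ {n} (M : Structure) → (Fin n → D M) → Term n → D M
evalT M ρ (var i) = ρ i
evalT M ρ r       = rᴹ M
evalT M ρ (t₁ t)  = t₁ᴹ M (evalT M ρ t)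
evalT M ρ (t₂ t)  = t₂ᴹ M (evalT M ρ t)

⟦_⟧ : ∀ {n} → Formula n → (M : Structure) → (Fin n → D M) → Set
⟦ P a b ⟧  M ρ = ¬ ¬ Pᴹ M (evalT M ρ a) (evalT M ρ b)
⟦ Q a b ⟧  M ρ = ¬ ¬ Qᴹ M (evalT M ρ a) (evalT M ρ b)
⟦ ⊤' ⟧     M ρ = ⊤
⟦ ⊥' ⟧     M ρ = ⊥
⟦ ¬' A ⟧   M ρ = ¬ ⟦ A ⟧ M ρ
⟦ A ∧' B ⟧ M ρ = ⟦ A ⟧ M ρ × ⟦ B ⟧ M ρ
⟦ A ∨' B ⟧ M ρ = ¬ ¬ (⟦ A ⟧ M ρ ⊎ ⟦ B ⟧ M ρ)
⟦ A ⇒' B ⟧ M ρ = ⟦ A ⟧ M ρ → ⟦ B ⟧ M ρ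
⟦ ∀' A ⟧   M ρ = (d : D M) → ⟦ A ⟧ M (cons d ρ)
⟦ ∃' A ⟧   M ρ = ¬ ¬ (Σ (D M) λ d → ⟦ A ⟧ M (cons d ρ))

record Sequent (n : ℕ) : Set where
  constructor _⊢_
  field
    ante succ : List (Formula n)

Tautology : ∀ {n} → Sequent n → Set₁
Tautology {n} (Γ ⊢ Δ) =
  (M : Structure) (ρ : Fin n → D M) →
  All (λ A → ⟦ A ⟧ M ρ) Γ → ¬ ¬ Any (λ A → ⟦ A ⟧ M ρ) Δ

α β₁ β₂ : Term 3
α  = var zero
β₁ = var (suc zero)
β₂ = var (suc (suc zero))

S : Formula 2 → Sequent 3
S C =
  ( (P α (t₁ α) ∧' Q α (t₂ α))
  ∷ ((C [ α , t₁ α ] ∨' C [ α , t₂ α ]) ⇒' (C [ r , β₁ ] ∧' C [ r , β₂ ]))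
  ∷ [] )
  ⊢
  ( (P r β₁ ∧' Q r β₂) ∷ [] )

-- Interpret the language in {0, 1, 2} with r = 0, t₁ = const 1, t₂ = const 2,
-- P(x, y) ⇔ y = 1 and Q(x, y) ⇔ y = 2, and assign α := 0 and β₁ = β₂ := b.
-- The first antecedent always holds, and the succedent never does, because
-- β₁ would have to be 1 and β₂ would have to be 2. Every instance of C in S(C)
-- is then evaluated at (0, 1), (0, 2) or (0, b). If C(0, b) held for some
-- b ∈ {1, 2}, the second antecedent would hold under β₁ = β₂ := b; so C(0, 1)
-- and C(0, 2) both fail, and the second antecedent holds vacuously.
module Submission where

open import Defs
open import Data.Empty using (⊥-elim)
open import Data.Fin using (Fin; zero; suc)
open import Data.List.Relation.Unary.All using ([]; _∷_)
open import Data.List.Relation.Unary.Any using (here)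
open import Data.Product using (Σ; _,_)
open import Data.Product.Function.Dependent.Propositional using (congˡ)
open import Data.Product.Function.NonDependent.Propositional using (_×-⇔_)
open import Data.Sum using ([_,_]′)
open import Data.Sum.Function.Propositional using (_⊎-⇔_)
open import Function.Base using (_∘_)
open import Function.Bundles using (_⇔_; mk⇔; Equivalence)
open import Function.Properties.Equivalence using () renaming (refl to ⇔-refl)
open import Function.Related.TypeIsomorphisms using (→-cong-⇔; ¬-cong-⇔)
open import Relation.Binary.PropositionalEquality using (_≡_; refl; cong)
open import Relation.Nullary using (¬_)

open Structure
open Equivalence using (to; from)

module _ {M : Structure} where

  evalT-renT : ∀ {m n} (f : Fin m → Fin n) (ρ : Fin n → D M) (t : Term m) →
               evalT M ρ (renT f t) ≡ evalT M (λ i → ρ (f i)) t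
  evalT-renT f ρ (var i) = refl
  evalT-renT f ρ r       = refl
  evalT-renT f ρ (t₁ t)  = cong (t₁ᴹ M) (evalT-renT f ρ t)
  evalT-renT f ρ (t₂ t)  = cong (t₂ᴹ M) (evalT-renT f ρ t)

  _⊨_≔_ : ∀ {m n} → (Fin n → D M) → (Fin m → Term n) → (Fin m → D M) → Set
  ρ ⊨ σ ≔ ρ′ = ∀ i → evalT M ρ (σ i) ≡ ρ′ i

  evalT-subT : ∀ {m n} {σ : Fin m → Term n} {ρ ρ′} → ρ ⊨ σ ≔ ρ′ →
               ∀ t → evalT M ρ (subT σ t) ≡ evalT M ρ′ t
  evalT-subT σ≔ (var i) = σ≔ i
  evalT-subT σ≔ r       = refl
  evalT-subT σ≔ (t₁ t)  = cong (t₁ᴹ M) (evalT-subT σ≔ t)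
  evalT-subT σ≔ (t₂ t)  = cong (t₂ᴹ M) (evalT-subT σ≔ t)

  ⊨-liftS : ∀ {m n} {σ : Fin m → Term n} {ρ ρ′} → ρ ⊨ σ ≔ ρ′ →
            ∀ d → cons d ρ ⊨ liftS σ ≔ cons d ρ′
  ⊨-liftS         σ≔ d zero    = refl
  ⊨-liftS {σ = σ} {ρ} σ≔ d (suc i) rewrite evalT-renT suc (cons d ρ) (σ i) = σ≔ i

  ⟦subF⟧ : ∀ {m n} {σ : Fin m → Term n} {ρ ρ′} → ρ ⊨ σ ≔ ρ′ →
           ∀ A → ⟦ subF σ A ⟧ M ρ ⇔ ⟦ A ⟧ M ρ′
  ⟦subF⟧ {σ = σ} σ≔ (P a b)
    rewrite evalT-subT {σ = σ} σ≔ a | evalT-subT {σ = σ} σ≔ b = ⇔-refl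
  ⟦subF⟧ {σ = σ} σ≔ (Q a b)
    rewrite evalT-subT {σ = σ} σ≔ a | evalT-subT {σ = σ} σ≔ b = ⇔-refl
  ⟦subF⟧ σ≔ ⊤'       = ⇔-refl
  ⟦subF⟧ σ≔ ⊥'       = ⇔-refl
  ⟦subF⟧ σ≔ (¬' A)   = ¬-cong-⇔ (⟦subF⟧ σ≔ A)
  ⟦subF⟧ σ≔ (A ∧' B) = ⟦subF⟧ σ≔ A ×-⇔ ⟦subF⟧ σ≔ B
  ⟦subF⟧ σ≔ (A ∨' B) = ¬-cong-⇔ (¬-cong-⇔ (⟦subF⟧ σ≔ A ⊎-⇔ ⟦subF⟧ σ≔ B))
  ⟦subF⟧ σ≔ (A ⇒' B) = →-cong-⇔ (⟦subF⟧ σ≔ A) (⟦subF⟧ σ≔ B)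
  ⟦subF⟧ σ≔ (∀' A)   =
    mk⇔ (λ u d → to (⟦subF⟧ (⊨-liftS σ≔ d) A) (u d))
        (λ u d → from (⟦subF⟧ (⊨-liftS σ≔ d) A) (u d))
  ⟦subF⟧ σ≔ (∃' A)   =
    ¬-cong-⇔ (¬-cong-⇔ (congˡ λ {d} → ⟦subF⟧ (⊨-liftS σ≔ d) A))

  ⟨_,_⟩ : D M → D M → Fin 2 → D M
  ⟨ a , b ⟩ zero       = a
  ⟨ a , b ⟩ (suc zero) = b

  ⟦_[_,_]⟧ : ∀ {n} (C : Formula 2) (s t : Term n) {ρ : Fin n → D M} →
             ⟦ C [ s , t ] ⟧ M ρ ⇔ ⟦ C ⟧ M ⟨ evalT M ρ s , evalT M ρ t ⟩
  ⟦ C [ s , t ]⟧ = ⟦subF⟧ (λ { zero → refl ; (suc zero) → refl }) C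

one two : Fin 3
one = suc zero
two = suc (suc zero)

ℳ : Structure
ℳ = record { D = Fin 3 ; Pᴹ = λ _ y → y ≡ one ; Qᴹ = λ _ y → y ≡ two
           ; rᴹ = zero ; t₁ᴹ = λ _ → one ; t₂ᴹ = λ _ → two }

α↦0,β↦_ : Fin 3 → Fin 3 → Fin 3
(α↦0,β↦ b) zero    = zero
(α↦0,β↦ b) (suc _) = b

second-antecedent-fails : ∀ {C} → Tautology (S C) → ∀ b →
  ¬ ⟦ (C [ α , t₁ α ] ∨' C [ α , t₂ α ]) ⇒' (C [ r , β₁ ] ∧' C [ r , β₂ ]) ⟧ ℳ (α↦0,β↦ b)
second-antecedent-fails taut b antecedent =
  taut ℳ (α↦0,β↦ b) (((λ k → k refl) , (λ k → k refl)) ∷ antecedent ∷ [])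
       λ { (here (β₁≡1 , β₂≡2)) → β₁≡1 λ { refl → β₂≡2 λ () } }

lemma2 : ¬ (Σ (Formula 2) λ C → Tautology (S C))
lemma2 (C , taut) =
  second-antecedent-fails taut one λ premise →
    ⊥-elim (premise [ C-false one ∘ to ⟦ C [ α , t₁ α ]⟧
                    , C-false two ∘ to ⟦ C [ α , t₂ α ]⟧ ]′)
  where
  C-false : ∀ b → ¬ ⟦ C ⟧ ℳ ⟨ zero , b ⟩
  C-false b c = second-antecedent-fails taut b λ _ →
    from ⟦ C [ r , β₁ ]⟧ c , from ⟦ C [ r , β₂ ]⟧ c
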